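{- Let $\mathbb{T}=(\Sigma,E)$ be an algebraic theory, $(\mathcal{C},i)$ a $\mathbb{T}$-rig category and $f\in\Sigma$ of arity $n$. For all objects $X,Y$ of $\mathcal{C}$: $$(f_X\otimes\mathrm{id}_Y);\delta^r_{nX,Y}=f_{X\otimes Y}\qquad\text{and}\qquad(\mathrm{id}_Y\otimes f_X);\delta^l_{Y,nX}=f_{Y\otimes X}.$$
   Context: Composition is diagrammatic. A $\mathbb{T}$-rig category is a rig category $\mathcal{C}$ (symmetric monoidal $(\otimes,1)$ with unitor $\lambda_X\colon1\otimes X\to X$, symmetric monoidal $(\oplus,0)$, natural isos $\delta^l_{X,Y,Z}\colon X\otimes(Y\oplus Z)\to(X\otimes Y)\oplus(X\otimes Z)$, $\delta^r_{X,Y,Z}\colon(X\oplus Y)\otimes Z\to(X\otimes Z)\oplus(Y\otimes Z)$, $\lambda^\bullet_X\colon0\otimes X\to0$, $\rho^\bullet_X\colon X\otimes0\to0$ with Laplaza's axioms) whose $\oplus$ is a finite coproduct, together with a morphism of fc categories $i\colon\mathbf{L}_{\mathbb{T}}^{op}\to\mathcal{C}$ with $d;i=c$, where $\mathbf{L}_{\mathbb{T}}$ is the Lawvere theory of $\mathbb{T}$, $d\colon\aleph_0\to\mathbf{L}_{\mathbb{T}}^{op}$ the identity-on-objects fc morphism from the free strict fc category on one object, and $c\colon\aleph_0\to\mathcal{C}$ sends $n$ to $\bigoplus_{i=1}^n1$. Sums are right-bracketed and $nX:=\bigoplus_{i=1}^nX$. Regarding $f$ as $f(x_1,..,x_n)\colon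 n\to1$ in $\mathbf{L}_{\mathbb{T}}$, $i(f)\colon1\to n1$, and $f_X:=\lambda_X^{ -1};(i(f)\otimes\mathrm{id}_X);\delta^r_{n,X}\colon X\to nX$, with $\delta^r_{0,X}=\lambda^\bullet_X$, $\delta^r_{1,X}=\lambda_X$, $\delta^r_{n+1,X}=\delta^r_{1,n1,X};(\lambda_X\oplus\delta^r_{n,X})$. Further $\delta^r_{nY,X}\colon(nY)\otimes X\to n(Y\otimes X)$ is given by $\delta^r_{0Y,X}=\lambda^\bullet_X$, $\delta^r_{1Y,X}=\mathrm{id}_{Y\otimes X}$, $\delta^r_{(n+1)Y,X}=\delta^r_{Y,nY,X};(\mathrm{id}_{Y\otimes X}\oplus\delta^r_{nY,X})$, and symmetrically $\delta^l_{Y,nX}\colon Y\otimes nX\to n(Y\otimes X)$ by $\delta^l_{Y,0X}=\rho^\bullet_Y$, $\delta^l_{Y,1X}=\mathrm{id}$, $\delta^l_{Y,(n+1)X}=\delta^l_{Y,X,nX};(\mathrm{id}_{Y\otimes X}\oplus\delta^l_{Y,nX})$. -}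

module Defs where

open import Level using (Level; _⊔_; suc; zero)
open import Data.Nat using (ℕ; _+_) renaming (zero to nzero; suc to nsuc)
open import Data.Fin using (Fin; _↑ˡ_; _↑ʳ_) renaming (zero to fzero; suc to fsuc)
open import Data.Product using (_×_; Σ)
open import Relation.Binary using (IsEquivalence)

record Category (o ℓ e : Level) : Set (Level.suc (o ⊔ ℓ ⊔ e)) where
  infixr 9 _⨾_
  infix  4 _≈_
  field
    Obj    : Set o
    _⇒_    : Obj → Obj → Set ℓ
    _≈_    : ∀ {A B} → A ⇒ B → A ⇒ B → Set e
    id     : ∀ {A} → A ⇒ A
    _⨾_    : ∀ {A B C} → A ⇒ B → B ⇒ C → A ⇒ C
    equiv  : ∀ {A B} → IsEquivalence (_≈_ {A} {B})
    ⨾-resp : ∀ {A B C} {f f' : A ⇒ B} {g g' : B ⇒ C} →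
             f ≈ f' → g ≈ g' → f ⨾ g ≈ f' ⨾ g'
    assoc  : ∀ {A B C D} {f : A ⇒ B} {g : B ⇒ C} {h : C ⇒ D} →
             (f ⨾ g) ⨾ h ≈ f ⨾ (g ⨾ h)
    idˡ    : ∀ {A B} {f : A ⇒ B} → id ⨾ f ≈ f
    idʳ    : ∀ {A B} {f : A ⇒ B} → f ⨾ id ≈ f

module _ {o ℓ e} (𝒞 : Category o ℓ e) where
  open Category 𝒞

  record SymmetricMonoidal : Set (o ⊔ ℓ ⊔ e) where
    infixr 10 _⊗₀_ _⊗₁_
    field
      _⊗₀_   : Obj → Obj → Obj
      _⊗₁_   : ∀ {A B C D} → A ⇒ B → C ⇒ D → (A ⊗₀ C) ⇒ (B ⊗₀ D)
      ⊗-id   : ∀ {A B} → id {A} ⊗₁ id {B} ≈ id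
      ⊗-⨾    : ∀ {A B C D E F} {f : A ⇒ B} {g : B ⇒ C} {h : D ⇒ E} {k : E ⇒ F} →
               (f ⨾ g) ⊗₁ (h ⨾ k) ≈ (f ⊗₁ h) ⨾ (g ⊗₁ k)
      ⊗-resp : ∀ {A B C D} {f f' : A ⇒ B} {g g' : C ⇒ D} →
               f ≈ f' → g ≈ g' → f ⊗₁ g ≈ f' ⊗₁ g'
      unit   : Obj
      α      : ∀ {A B C} → (A ⊗₀ (B ⊗₀ C)) ⇒ ((A ⊗₀ B) ⊗₀ C)
      α⁻¹    : ∀ {A B C} → ((A ⊗₀ B) ⊗₀ C) ⇒ (A ⊗₀ (B ⊗₀ C))
      α-isoˡ : ∀ {A B C} → α {A} {B} {C} ⨾ α⁻¹ ≈ id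
      α-isoʳ : ∀ {A B C} → α⁻¹ ⨾ α {A} {B} {C} ≈ id
      α-nat  : ∀ {A B C D E F} {f : A ⇒ D} {g : B ⇒ E} {h : C ⇒ F} →
               (f ⊗₁ (g ⊗₁ h)) ⨾ α ≈ α ⨾ ((f ⊗₁ g) ⊗₁ h)
      unitˡ     : ∀ {A} → (unit ⊗₀ A) ⇒ A
      unitˡ⁻¹   : ∀ {A} → A ⇒ (unit ⊗₀ A)
      unitˡ-isoˡ : ∀ {A} → unitˡ {A} ⨾ unitˡ⁻¹ ≈ id
      unitˡ-isoʳ : ∀ {A} → unitˡ⁻¹ ⨾ unitˡ {A} ≈ id
      unitˡ-nat : ∀ {A B} {f : A ⇒ B} → (id ⊗₁ f) ⨾ unitˡ ≈ unitˡ ⨾ f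
      unitʳ     : ∀ {A} → (A ⊗₀ unit) ⇒ A
      unitʳ⁻¹   : ∀ {A} → A ⇒ (A ⊗₀ unit)
      unitʳ-isoˡ : ∀ {A} → unitʳ {A} ⨾ unitʳ⁻¹ ≈ id
      unitʳ-isoʳ : ∀ {A} → unitʳ⁻¹ ⨾ unitʳ {A} ≈ id
      unitʳ-nat : ∀ {A B} {f : A ⇒ B} → (f ⊗₁ id) ⨾ unitʳ ≈ unitʳ ⨾ f
      σ      : ∀ {A B} → (A ⊗₀ B) ⇒ (B ⊗₀ A)
      σ-nat  : ∀ {A B C D} {f : A ⇒ B} {g : C ⇒ D} →
               (f ⊗₁ g) ⨾ σ ≈ σ ⨾ (g ⊗₁ f)
      σ-inv  : ∀ {A B} → σ {A} {B} ⨾ σ ≈ id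
      triangle : ∀ {A B} → α {A} {unit} {B} ⨾ (unitʳ ⊗₁ id) ≈ id ⊗₁ unitˡ
      pentagon : ∀ {A B C D} →
                 α {A} {B} {C ⊗₀ D} ⨾ α {A ⊗₀ B} {C} {D}
                 ≈ (id ⊗₁ α) ⨾ α {A} {B ⊗₀ C} {D} ⨾ (α ⊗₁ id)
      hexagon  : ∀ {A B C} →
                 α {A} {B} {C} ⨾ σ ⨾ α
                 ≈ (id ⊗₁ σ) ⨾ α ⨾ (σ ⊗₁ id)

module _ {o ℓ e} {𝒞 : Category o ℓ e}
         (M P : SymmetricMonoidal 𝒞) where
  open Category 𝒞
  open SymmetricMonoidal M
  open SymmetricMonoidal P using () renaming
    ( _⊗₀_ to _⊕₀_ ; _⊗₁_ to _⊕₁_ ; unit to 𝟘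
    ; α to α⊕ ; α⁻¹ to α⊕⁻¹ ; unitˡ to unitˡ⊕ ; unitʳ to unitʳ⊕ ; σ to σ⊕ )

  record RigAxioms : Set (o ⊔ ℓ ⊔ e) where
    infixr 9 _⊕_
    private
      _⊕_ = _⊕₀_
    field
      δˡ      : ∀ {A B C} → (A ⊗₀ (B ⊕ C)) ⇒ ((A ⊗₀ B) ⊕ (A ⊗₀ C))
      δˡ⁻¹    : ∀ {A B C} → ((A ⊗₀ B) ⊕ (A ⊗₀ C)) ⇒ (A ⊗₀ (B ⊕ C))
      δˡ-isoˡ : ∀ {A B C} → δˡ {A} {B} {C} ⨾ δˡ⁻¹ ≈ id
      δˡ-isoʳ : ∀ {A B C} → δˡ⁻¹ ⨾ δˡ {A} {B} {C} ≈ id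
      δˡ-nat  : ∀ {A B C D E F} {f : A ⇒ D} {g : B ⇒ E} {h : C ⇒ F} →
                (f ⊗₁ (g ⊕₁ h)) ⨾ δˡ ≈ δˡ ⨾ ((f ⊗₁ g) ⊕₁ (f ⊗₁ h))
      δʳ      : ∀ {A B C} → ((A ⊕ B) ⊗₀ C) ⇒ ((A ⊗₀ C) ⊕ (B ⊗₀ C))
      δʳ⁻¹    : ∀ {A B C} → ((A ⊗₀ C) ⊕ (B ⊗₀ C)) ⇒ ((A ⊕ B) ⊗₀ C)
      δʳ-isoˡ : ∀ {A B C} → δʳ {A} {B} {C} ⨾ δʳ⁻¹ ≈ id
      δʳ-isoʳ : ∀ {A B C} → δʳ⁻¹ ⨾ δʳ {A} {B} {C} ≈ id
      δʳ-nat  : ∀ {A B C D E F} {f : A ⇒ D} {g : B ⇒ E} {h : C ⇒ F} →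
                ((f ⊕₁ g) ⊗₁ h) ⨾ δʳ ≈ δʳ ⨾ ((f ⊗₁ h) ⊕₁ (g ⊗₁ h))
      λ•      : ∀ {A} → (𝟘 ⊗₀ A) ⇒ 𝟘
      λ•⁻¹    : ∀ {A} → 𝟘 ⇒ (𝟘 ⊗₀ A)
      λ•-isoˡ : ∀ {A} → λ• {A} ⨾ λ•⁻¹ ≈ id
      λ•-isoʳ : ∀ {A} → λ•⁻¹ ⨾ λ• {A} ≈ id
      λ•-nat  : ∀ {A B} {f : A ⇒ B} → (id ⊗₁ f) ⨾ λ• ≈ λ•
      ρ•      : ∀ {A} → (A ⊗₀ 𝟘) ⇒ 𝟘
      ρ•⁻¹    : ∀ {A} → 𝟘 ⇒ (A ⊗₀ 𝟘)
      ρ•-isoˡ : ∀ {A} → ρ• {A} ⨾ ρ•⁻¹ ≈ id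
      ρ•-isoʳ : ∀ {A} → ρ•⁻¹ ⨾ ρ• {A} ≈ id
      ρ•-nat  : ∀ {A B} {f : A ⇒ B} → (f ⊗₁ id) ⨾ ρ• ≈ ρ•
      laplaza-I     : ∀ {A B C} → δˡ {A} {B} {C} ⨾ σ⊕ ≈ (id ⊗₁ σ⊕) ⨾ δˡ
      laplaza-II    : ∀ {A B C} → δʳ {A} {B} {C} ⨾ (σ ⊕₁ σ) ≈ σ ⨾ δˡ
      laplaza-III   : ∀ {A B C} → δʳ {A} {B} {C} ⨾ σ⊕ ≈ (σ⊕ ⊗₁ id) ⨾ δʳ
      laplaza-IV    : ∀ {A B C D} →
                      δˡ {A} {B} {C ⊕ D} ⨾ (id ⊕₁ δˡ) ⨾ α⊕
                      ≈ (id ⊗₁ α⊕) ⨾ δˡ ⨾ (δˡ ⊕₁ id)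
      laplaza-V     : ∀ {A B C D} →
                      δʳ {A} {B ⊕ C} {D} ⨾ (id ⊕₁ δʳ) ⨾ α⊕
                      ≈ (α⊕ ⊗₁ id) ⨾ δʳ ⨾ (δʳ ⊕₁ id)
      laplaza-VI    : ∀ {A B C D} →
                      (id {A} ⊗₁ δˡ {B} {C} {D}) ⨾ δˡ ⨾ (α ⊕₁ α) ≈ α ⨾ δˡ
      laplaza-VII   : ∀ {A B C D} →
                      α {A} {B ⊕ C} {D} ⨾ (δˡ ⊗₁ id) ⨾ δʳ
                      ≈ (id ⊗₁ δʳ) ⨾ δˡ ⨾ (α ⊕₁ α)
      laplaza-VIII  : ∀ {A B C D} →
                      α {A ⊕ B} {C} {D} ⨾ (δʳ ⊗₁ id) ⨾ δʳ ≈ δʳ ⨾ (α ⊕₁ α)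
      laplaza-IX    : ∀ {A B C D} →
                      δʳ {A} {B} {C ⊕ D} ⨾ (δˡ ⊕₁ δˡ)
                      ⨾ α⊕⁻¹ ⨾ (id ⊕₁ α⊕) ⨾ (id ⊕₁ (σ⊕ ⊕₁ id))
                      ⨾ (id ⊕₁ α⊕⁻¹) ⨾ α⊕
                      ≈ δˡ ⨾ (δʳ ⊕₁ δʳ)
      laplaza-X     : λ• {𝟘} ≈ ρ• {𝟘}
      laplaza-XI    : ∀ {A B} → δˡ {𝟘} {A} {B} ⨾ (λ• ⊕₁ λ•) ⨾ unitˡ⊕ ≈ λ•
      laplaza-XII   : ∀ {A B} → δʳ {A} {B} {𝟘} ⨾ (ρ• ⊕₁ ρ•) ⨾ unitˡ⊕ ≈ ρ•
      laplaza-XIII  : λ• {unit} ≈ unitʳ {𝟘}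
      laplaza-XIV   : ρ• {unit} ≈ unitˡ {𝟘}
      laplaza-XV    : ∀ {A} → ρ• {A} ≈ σ ⨾ λ•
      laplaza-XVI   : ∀ {A B} → α {𝟘} {A} {B} ⨾ (λ• ⊗₁ id) ⨾ λ• ≈ λ•
      laplaza-XVII  : ∀ {A B} → α {A} {B} {𝟘} ⨾ ρ• ≈ (id ⊗₁ ρ•) ⨾ ρ•
      laplaza-XVIII : ∀ {A B} → α {A} {𝟘} {B} ⨾ (ρ• ⊗₁ id) ⨾ λ• ≈ (id ⊗₁ λ•) ⨾ ρ•
      laplaza-XIX   : ∀ {A B} → δˡ {A} {B} {𝟘} ⨾ (id ⊕₁ ρ•) ⨾ unitʳ⊕ ≈ id ⊗₁ unitʳ⊕
      laplaza-XX    : ∀ {A B} → δˡ {A} {𝟘} {B} ⨾ (ρ• ⊕₁ id) ⨾ unitˡ⊕ ≈ id ⊗₁ unitˡ⊕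
      laplaza-XXI   : ∀ {A B} → δʳ {A} {𝟘} {B} ⨾ (id ⊕₁ λ•) ⨾ unitʳ⊕ ≈ unitʳ⊕ ⊗₁ id
      laplaza-XXII  : ∀ {A B} → δʳ {𝟘} {A} {B} ⨾ (λ• ⊕₁ id) ⨾ unitˡ⊕ ≈ unitˡ⊕ ⊗₁ id
      laplaza-XXIII : ∀ {A B} → δˡ {unit} {A} {B} ⨾ (unitˡ ⊕₁ unitˡ) ≈ unitˡ
      laplaza-XXIV  : ∀ {A B} → δʳ {A} {B} {unit} ⨾ (unitʳ ⊕₁ unitʳ) ≈ unitʳ

module _ {o ℓ e} {𝒞 : Category o ℓ e} (P : SymmetricMonoidal 𝒞) where
  open Category 𝒞
  open SymmetricMonoidal P renaming (_⊗₀_ to _⊕₀_ ; _⊗₁_ to _⊕₁_ ; unit to 𝟘)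

  record IsCocartesian : Set (o ⊔ ℓ ⊔ e) where
    field
      ¡        : ∀ {A} → 𝟘 ⇒ A
      ¡-unique : ∀ {A} (f : 𝟘 ⇒ A) → f ≈ ¡
      inl      : ∀ {A B} → A ⇒ (A ⊕₀ B)
      inr      : ∀ {A B} → B ⇒ (A ⊕₀ B)
      [_,_]    : ∀ {A B C} → A ⇒ C → B ⇒ C → (A ⊕₀ B) ⇒ C
      inl-β    : ∀ {A B C} {f : A ⇒ C} {g : B ⇒ C} → inl ⨾ [ f , g ] ≈ f
      inr-β    : ∀ {A B C} {f : A ⇒ C} {g : B ⇒ C} → inr ⨾ [ f , g ] ≈ g
      []-η     : ∀ {A B C} {f : A ⇒ C} {g : B ⇒ C} {h : (A ⊕₀ B) ⇒ C} →
                 inl ⨾ h ≈ f → inr ⨾ h ≈ g → h ≈ [ f , g ]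
      ⊕₁-def   : ∀ {A B C D} {f : A ⇒ B} {g : C ⇒ D} →
                 f ⊕₁ g ≈ [ f ⨾ inl , g ⨾ inr ]
      α-def    : ∀ {A B C} → α {A} {B} {C} ≈ [ inl ⨾ inl , [ inr ⨾ inl , inr ] ]
      unitˡ-def : ∀ {A} → unitˡ {A} ≈ [ ¡ , id ]
      unitʳ-def : ∀ {A} → unitʳ {A} ≈ [ id , ¡ ]
      σ-def    : ∀ {A B} → σ {A} {B} ≈ [ inr , inl ]

record Signature : Set₁ where
  field
    Op    : Set
    arity : Op → ℕ

module _ (S : Signature) where
  open Signature S

  data Term (n : ℕ) : Set where
    var : Fin n → Term n
    op  : (f : Op) → (Fin (arity f) → Term n) → Term n

module _ {S : Signature} where
  open Signature S

  subst : ∀ {n m} → (Fin n → Term S m) → Term S n → Term S m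
  subst s (var x)   = s x
  subst s (op f ts) = op f (λ k → subst s (ts k))

record Theory : Set₁ where
  field
    sig   : Signature
    Eqn   : Set
    ctx   : Eqn → ℕ
    lhs   : (e : Eqn) → Term sig (ctx e)
    rhs   : (e : Eqn) → Term sig (ctx e)

module _ (T : Theory) where
  open Theory T
  open Signature sig

  infix 4 _⊢_≈_
  data _⊢_≈_ {n : ℕ} : Term sig n → Term sig n → Set where
    ≈-refl  : ∀ {t} → _⊢_≈_ t t
    ≈-sym   : ∀ {s t} → _⊢_≈_ s t → _⊢_≈_ t s
    ≈-trans : ∀ {s t u} → _⊢_≈_ s t → _⊢_≈_ t u → _⊢_≈_ s u
    ≈-cong  : ∀ (f : Op) {ss ts : Fin (arity f) → Term sig n} →
              (∀ k → _⊢_≈_ (ss k) (ts k)) → _⊢_≈_ (op f ss) (op f ts)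
    ≈-ax    : ∀ (eq : Eqn) (s : Fin (ctx eq) → Term sig n) →
              _⊢_≈_ (subst s (lhs eq)) (subst s (rhs eq))

  -- Lawvere theory L_T : a morphism n → m is an m-tuple of terms in n
  -- variables, modulo E; composition is substitution.
  LHom : ℕ → ℕ → Set
  LHom n m = Fin m → Term sig n

  _≈L_ : ∀ {n m} → LHom n m → LHom n m → Set
  u ≈L v = ∀ k → _⊢_≈_ (u k) (v k)

  idL : ∀ {n} → LHom n n
  idL = var

  _⨾L_ : ∀ {n m k} → LHom n m → LHom m k → LHom n k
  (u ⨾L v) j = subst u (v j)

  opL : (f : Op) → LHom (arity f) 1
  opL f _ = op f var

module _ {o ℓ e} {𝒞 : Category o ℓ e} (P : SymmetricMonoidal 𝒞) where
  open Category 𝒞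
  open SymmetricMonoidal P renaming (_⊗₀_ to _⊕₀_ ; unit to 𝟘)

  times : ℕ → Obj → Obj
  times nzero           X = 𝟘
  times (nsuc nzero)    X = X
  times (nsuc (nsuc n)) X = X ⊕₀ times (nsuc n) X

module _ {o ℓ e} {𝒞 : Category o ℓ e} {P : SymmetricMonoidal 𝒞}
         (cc : IsCocartesian P) where
  open Category 𝒞
  open IsCocartesian cc

  ι : ∀ (n : ℕ) {X} → Fin n → X ⇒ times P n X
  ι (nsuc nzero)    fzero    = id
  ι (nsuc (nsuc n)) fzero    = inl
  ι (nsuc (nsuc n)) (fsuc k) = ι (nsuc n) k ⨾ inr

  copair : ∀ (n : ℕ) {X Y} → (Fin n → X ⇒ Y) → times P n X ⇒ Y
  copair nzero           fs = ¡
  copair (nsuc nzero)    fs = fs fzero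
  copair (nsuc (nsuc n)) fs = [ fs fzero , copair (nsuc n) (λ k → fs (fsuc k)) ]

  -- c : ℵ₀ → 𝒞 on a morphism φ : n → m of ℵ₀ (a function Fin n → Fin m)
  cMor : ∀ {n m} {X} → (Fin n → Fin m) → times P n X ⇒ times P m X
  cMor {n} {m} φ = copair n (λ k → ι m (φ k))

record TRigCategory (T : Theory) (o ℓ e : Level) : Set (Level.suc (o ⊔ ℓ ⊔ e)) where
  field
    𝒞       : Category o ℓ e
    ⊗S      : SymmetricMonoidal 𝒞
    ⊕S      : SymmetricMonoidal 𝒞
    rig     : RigAxioms ⊗S ⊕S
    cocart  : IsCocartesian ⊕S
  open Category 𝒞
  open SymmetricMonoidal ⊗S using (unit)
  open IsCocartesian cocart
  private
    c₀ : ℕ → Obj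
    c₀ n = times ⊕S n unit
  field
    -- i : L_T^op → 𝒞 ; on objects i n = c n = n·1 (forced by d ; i = c,
    -- d being identity on objects).  A morphism a → b of L_T^op is a
    -- morphism b → a of L_T.
    i        : ∀ {a b} → LHom T b a → c₀ a ⇒ c₀ b
    i-resp   : ∀ {a b} {u v : LHom T b a} → _≈L_ T u v → i u ≈ i v
    i-id     : ∀ {a} → i (idL T {a}) ≈ id
    -- composition in L_T^op of u : a → b and v : b → c is  v ⨾L u
    i-⨾      : ∀ {a b c} {u : LHom T b a} {v : LHom T c b} →
               i (_⨾L_ T v u) ≈ i u ⨾ i v
    -- morphism of fc categories: preserves binary coproducts (the
    -- injections of a + b in L_T^op are d(inl), d(inr)).  Preservation of
    -- the initial object is automatic: i 0 = c 0 = 0, initial by cocart.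
    i-coprod  : ∀ {a b A} (f : c₀ a ⇒ A) (g : c₀ b ⇒ A) →
                Σ (c₀ (a + b) ⇒ A) λ h →
                  (i {a} {a + b} (λ k → var (k ↑ˡ b)) ⨾ h ≈ f)
                  × (i {b} {a + b} (λ k → var (a ↑ʳ k)) ⨾ h ≈ g)
                  × (∀ h' → i {a} {a + b} (λ k → var (k ↑ˡ b)) ⨾ h' ≈ f →
                            i {b} {a + b} (λ k → var (a ↑ʳ k)) ⨾ h' ≈ g → h' ≈ h)
    -- d ; i = c : for φ : Fin a → Fin b in ℵ₀, d φ = (x_{φ k})_k
    d⨾i≡c    : ∀ {a b} (φ : Fin a → Fin b) → i (λ k → var (φ k)) ≈ cMor cocart φ

module TRigOps {T : Theory} {o ℓ e} (R : TRigCategory T o ℓ e) where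
  open TRigCategory R
  open Category 𝒞 public
  open SymmetricMonoidal ⊗S public
  open SymmetricMonoidal ⊕S public using () renaming (_⊗₁_ to _⊕₁_)
  open RigAxioms rig public
  open Signature (Theory.sig T)

  δʳ-n1 : ∀ (n : ℕ) (X : Obj) → (times ⊕S n unit ⊗₀ X) ⇒ times ⊕S n X
  δʳ-n1 nzero           X = λ•
  δʳ-n1 (nsuc nzero)    X = unitˡ
  δʳ-n1 (nsuc (nsuc n)) X = δʳ ⨾ (unitˡ ⊕₁ δʳ-n1 (nsuc n) X)

  δʳ-nY : ∀ (n : ℕ) (Y X : Obj) → (times ⊕S n Y ⊗₀ X) ⇒ times ⊕S n (Y ⊗₀ X)
  δʳ-nY nzero           Y X = λ•
  δʳ-nY (nsuc nzero)    Y X = id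
  δʳ-nY (nsuc (nsuc n)) Y X = δʳ ⨾ (id ⊕₁ δʳ-nY (nsuc n) Y X)

  δˡ-nX : ∀ (Y : Obj) (n : ℕ) (X : Obj) → (Y ⊗₀ times ⊕S n X) ⇒ times ⊕S n (Y ⊗₀ X)
  δˡ-nX Y nzero           X = ρ•
  δˡ-nX Y (nsuc nzero)    X = id
  δˡ-nX Y (nsuc (nsuc n)) X = δˡ ⨾ (id ⊕₁ δˡ-nX Y (nsuc n) X)

  opAt : (f : Op) (X : Obj) → X ⇒ times ⊕S (arity f) X
  opAt f X = unitˡ⁻¹ ⨾ (i (opL T f) ⊗₁ id) ⨾ δʳ-n1 (arity f) X

-- Both identities hold for h_X := λ⁻¹ ; (h ⊗ id) ; δʳ_{n,X} with h : 1 → n1 arbitrary;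
-- the theory only supplies h = i(f).  The first reduces, by naturality of α, to the
-- coherence  α ; (δʳ_{n,X} ⊗ id) ; δʳ_{nX,Y} = δʳ_{n,X⊗Y},  which follows by induction
-- on n from Laplaza's axioms VIII and XVI and Kelly's lemma α ; (λ ⊗ id) = λ.  The
-- second follows from the first by conjugating with the symmetry: Laplaza's axiom II
-- turns δˡ into δʳ up to σ, and h_X is natural in X.
module Submission where

open import Defs
open import Level using (Level)
open import Data.Nat using (ℕ) renaming (zero to nzero; suc to nsuc)
open import Data.Product using (_×_; _,_)
open import Relation.Binary using (Setoid; IsEquivalence)
import Relation.Binary.Reasoning.Setoid as SetoidReasoning

module CategoryReasoning {o ℓ e} (𝒞 : Category o ℓ e) where
  open Category 𝒞

  hom-setoid : Obj → Obj → Setoid ℓ e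
  hom-setoid A B = record { Carrier = A ⇒ B ; _≈_ = _≈_ ; isEquivalence = equiv }

  module HomReasoning {A B : Obj} where
    open IsEquivalence (equiv {A} {B}) public using (refl; sym; trans)
    open SetoidReasoning (hom-setoid A B) public
  open HomReasoning public

  infixr 4 _⟩⨾⟨_ refl⟩⨾⟨_
  infixl 5 _⟩⨾⟨refl

  _⟩⨾⟨_ : ∀ {A B C} {f f' : A ⇒ B} {g g' : B ⇒ C} → f ≈ f' → g ≈ g' → f ⨾ g ≈ f' ⨾ g'
  _⟩⨾⟨_ = ⨾-resp

  refl⟩⨾⟨_ : ∀ {A B C} {f : A ⇒ B} {g g' : B ⇒ C} → g ≈ g' → f ⨾ g ≈ f ⨾ g'
  refl⟩⨾⟨ p = refl ⟩⨾⟨ p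

  _⟩⨾⟨refl : ∀ {A B C} {f f' : A ⇒ B} {g : B ⇒ C} → f ≈ f' → f ⨾ g ≈ f' ⨾ g
  p ⟩⨾⟨refl = p ⟩⨾⟨ refl

  module _ {A B C D : Obj} {f : A ⇒ B} {g : B ⇒ C} {k : C ⇒ D} where
    pullˡ : ∀ {h : A ⇒ C} → f ⨾ g ≈ h → f ⨾ g ⨾ k ≈ h ⨾ k
    pullˡ p = trans (sym assoc) (p ⟩⨾⟨refl)

    pushˡ : ∀ {h : A ⇒ C} → h ≈ f ⨾ g → h ⨾ k ≈ f ⨾ g ⨾ k
    pushˡ p = trans (p ⟩⨾⟨refl) assoc

  extendˡ : ∀ {A B B' C D} {f : A ⇒ B} {g : B ⇒ C} {f' : A ⇒ B'} {g' : B' ⇒ C} {k : C ⇒ D} →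
            f ⨾ g ≈ f' ⨾ g' → f ⨾ g ⨾ k ≈ f' ⨾ g' ⨾ k
  extendˡ p = trans (pullˡ p) assoc

  pull₃ : ∀ {A B C D E} {f : A ⇒ B} {g : B ⇒ C} {h : C ⇒ D} {k : D ⇒ E} {u : A ⇒ D} →
          f ⨾ g ⨾ h ≈ u → f ⨾ g ⨾ h ⨾ k ≈ u ⨾ k
  pull₃ p = trans (refl⟩⨾⟨ sym assoc) (pullˡ p)

  cancelˡ : ∀ {A B C} {f : A ⇒ B} {g : B ⇒ A} {h : A ⇒ C} → f ⨾ g ≈ id → f ⨾ g ⨾ h ≈ h
  cancelˡ p = trans (pullˡ p) idˡ

  left-invertible-cancel : ∀ {A B C} {f : A ⇒ B} {f⁻¹ : B ⇒ A} {p q : B ⇒ C} →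
                           f⁻¹ ⨾ f ≈ id → f ⨾ p ≈ f ⨾ q → p ≈ q
  left-invertible-cancel {f = f} {f⁻¹} {p} {q} inv r = begin
    p               ≈⟨ cancelˡ inv ⟨
    f⁻¹ ⨾ f ⨾ p     ≈⟨ refl⟩⨾⟨ r ⟩
    f⁻¹ ⨾ f ⨾ q     ≈⟨ cancelˡ inv ⟩
    q               ∎

  right-invertible-cancel : ∀ {A B C} {f : B ⇒ C} {f⁻¹ : C ⇒ B} {p q : A ⇒ B} →
                            f ⨾ f⁻¹ ≈ id → p ⨾ f ≈ q ⨾ f → p ≈ q
  right-invertible-cancel {f = f} {f⁻¹} {p} {q} inv r = begin
    p               ≈⟨ idʳ ⟨
    p ⨾ id          ≈⟨ refl⟩⨾⟨ inv ⟨
    p ⨾ f ⨾ f⁻¹     ≈⟨ pullˡ r ⟩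
    (q ⨾ f) ⨾ f⁻¹   ≈⟨ assoc ⟩
    q ⨾ f ⨾ f⁻¹     ≈⟨ refl⟩⨾⟨ inv ⟩
    q ⨾ id          ≈⟨ idʳ ⟩
    q               ∎

  conjugate : ∀ {A B C D} {a : A ⇒ B} {a⁻¹ : B ⇒ A} {b : C ⇒ D} {b⁻¹ : D ⇒ C}
                {x : A ⇒ C} {y : B ⇒ D} →
              a⁻¹ ⨾ a ≈ id → b ⨾ b⁻¹ ≈ id → x ⨾ b ≈ a ⨾ y → a⁻¹ ⨾ x ≈ y ⨾ b⁻¹
  conjugate {a = a} {a⁻¹} {b} {b⁻¹} {x} {y} inv-a inv-b r = begin
    a⁻¹ ⨾ x              ≈⟨ idʳ ⟨
    (a⁻¹ ⨾ x) ⨾ id       ≈⟨ refl⟩⨾⟨ inv-b ⟨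
    (a⁻¹ ⨾ x) ⨾ b ⨾ b⁻¹  ≈⟨ trans assoc (refl⟩⨾⟨ pullˡ r) ⟩
    a⁻¹ ⨾ (a ⨾ y) ⨾ b⁻¹  ≈⟨ refl⟩⨾⟨ assoc ⟩
    a⁻¹ ⨾ a ⨾ y ⨾ b⁻¹    ≈⟨ cancelˡ inv-a ⟩
    y ⨾ b⁻¹              ∎

module MonoidalProperties {o ℓ e} {𝒞 : Category o ℓ e} (M : SymmetricMonoidal 𝒞) where
  open Category 𝒞
  open CategoryReasoning 𝒞
  open SymmetricMonoidal M

  id⊗⨾ : ∀ {A B C D} {f : B ⇒ C} {g : C ⇒ D} → id {A} ⊗₁ (f ⨾ g) ≈ (id ⊗₁ f) ⨾ (id ⊗₁ g)
  id⊗⨾ = trans (⊗-resp (sym idˡ) refl) ⊗-⨾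

  ⨾⊗id : ∀ {A B C D} {f : B ⇒ C} {g : C ⇒ D} → (f ⨾ g) ⊗₁ id {A} ≈ (f ⊗₁ id) ⨾ (g ⊗₁ id)
  ⨾⊗id = trans (⊗-resp refl (sym idˡ)) ⊗-⨾

  ⊗-slide : ∀ {A B C D} {f : A ⇒ B} {g : C ⇒ D} →
            (f ⊗₁ id) ⨾ (id ⊗₁ g) ≈ (id ⊗₁ g) ⨾ (f ⊗₁ id)
  ⊗-slide = trans (sym ⊗-⨾) (trans (⊗-resp (trans idʳ (sym idˡ)) (trans idˡ (sym idʳ))) ⊗-⨾)

  unitˡ⁻¹-nat : ∀ {A B} {f : A ⇒ B} → f ⨾ unitˡ⁻¹ ≈ unitˡ⁻¹ ⨾ (id ⊗₁ f)
  unitˡ⁻¹-nat = sym (conjugate unitˡ-isoʳ unitˡ-isoˡ unitˡ-nat)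

  α⁻¹-nat : ∀ {A B C D E F} {f : A ⇒ D} {g : B ⇒ E} {h : C ⇒ F} →
            ((f ⊗₁ g) ⊗₁ h) ⨾ α⁻¹ ≈ α⁻¹ ⨾ (f ⊗₁ (g ⊗₁ h))
  α⁻¹-nat = sym (conjugate α-isoʳ α-isoˡ α-nat)

  unit⊗-injective : ∀ {A B} {f g : A ⇒ B} → id {unit} ⊗₁ f ≈ id ⊗₁ g → f ≈ g
  unit⊗-injective {f = f} {g} p = left-invertible-cancel unitˡ-isoʳ (begin
    unitˡ ⨾ f        ≈⟨ unitˡ-nat ⟨
    (id ⊗₁ f) ⨾ unitˡ ≈⟨ p ⟩⨾⟨refl ⟩
    (id ⊗₁ g) ⨾ unitˡ ≈⟨ unitˡ-nat ⟩
    unitˡ ⨾ g        ∎)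

  -- Kelly's lemma: tensor with the unit on the left and use the pentagon and triangle.
  α-unitˡ : ∀ {A B} → α {unit} {A} {B} ⨾ (unitˡ ⊗₁ id) ≈ unitˡ
  α-unitˡ = unit⊗-injective (right-invertible-cancel α-isoˡ (begin
    (id ⊗₁ (α ⨾ (unitˡ ⊗₁ id))) ⨾ α          ≈⟨ pushˡ id⊗⨾ ⟩
    (id ⊗₁ α) ⨾ (id ⊗₁ (unitˡ ⊗₁ id)) ⨾ α   ≈⟨ refl⟩⨾⟨ α-nat ⟩
    (id ⊗₁ α) ⨾ α ⨾ ((id ⊗₁ unitˡ) ⊗₁ id)   ≈⟨ refl⟩⨾⟨ refl⟩⨾⟨ ⊗-resp triangle refl ⟨
    (id ⊗₁ α) ⨾ α ⨾ ((α ⨾ (unitʳ ⊗₁ id)) ⊗₁ id)   ≈⟨ refl⟩⨾⟨ refl⟩⨾⟨ ⨾⊗id ⟩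
    (id ⊗₁ α) ⨾ α ⨾ (α ⊗₁ id) ⨾ ((unitʳ ⊗₁ id) ⊗₁ id) ≈⟨ pull₃ (sym pentagon) ⟩
    (α ⨾ α) ⨾ ((unitʳ ⊗₁ id) ⊗₁ id)         ≈⟨ assoc ⟩
    α ⨾ α ⨾ ((unitʳ ⊗₁ id) ⊗₁ id)           ≈⟨ refl⟩⨾⟨ α-nat ⟨
    α ⨾ (unitʳ ⊗₁ (id ⊗₁ id)) ⨾ α           ≈⟨ refl⟩⨾⟨ ⊗-resp refl ⊗-id ⟩⨾⟨refl ⟩
    α ⨾ (unitʳ ⊗₁ id) ⨾ α                   ≈⟨ pullˡ triangle ⟩
    (id ⊗₁ unitˡ) ⨾ α                       ∎))

  unitˡ⁻¹-α⁻¹ : ∀ {A B} → (unitˡ⁻¹ ⊗₁ id {B}) ⨾ α⁻¹ ≈ unitˡ⁻¹ {A ⊗₀ B}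
  unitˡ⁻¹-α⁻¹ {A} {B} = trans (conjugate unitˡ⊗id-iso unitˡ-isoˡ α⁻¹-unitˡ) idˡ
    where
      unitˡ⊗id-iso : (unitˡ⁻¹ ⊗₁ id) ⨾ (unitˡ ⊗₁ id) ≈ id {A ⊗₀ B}
      unitˡ⊗id-iso = trans (sym ⊗-⨾) (trans (⊗-resp unitˡ-isoʳ idˡ) ⊗-id)
      α⁻¹-unitˡ : α⁻¹ ⨾ unitˡ ≈ (unitˡ ⊗₁ id {B}) ⨾ id {A ⊗₀ B}
      α⁻¹-unitˡ = trans (refl⟩⨾⟨ sym α-unitˡ) (trans (cancelˡ α-isoʳ) (sym idʳ))

module TRigProperties {T : Theory} {o ℓ e} (R : TRigCategory T o ℓ e) where
  open TRigOps R
  open TRigCategory R using (𝒞; ⊗S; ⊕S)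
  open CategoryReasoning 𝒞
  open MonoidalProperties ⊗S
  open SymmetricMonoidal ⊕S using () renaming (⊗-⨾ to ⊕-⨾; ⊗-resp to ⊕-resp; ⊗-id to ⊕-id)

  times₁ : ∀ n {A B} → A ⇒ B → times ⊕S n A ⇒ times ⊕S n B
  times₁ nzero           g = id
  times₁ (nsuc nzero)    g = g
  times₁ (nsuc (nsuc n)) g = g ⊕₁ times₁ (nsuc n) g

  δʳ-n1-natural : ∀ n {A B} (g : A ⇒ B) → (id ⊗₁ g) ⨾ δʳ-n1 n B ≈ δʳ-n1 n A ⨾ times₁ n g
  δʳ-n1-natural nzero           g = trans λ•-nat (sym idʳ)
  δʳ-n1-natural (nsuc nzero)    g = unitˡ-nat
  δʳ-n1-natural (nsuc (nsuc n)) {A} {B} g = begin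
    (id ⊗₁ g) ⨾ δʳ ⨾ (unitˡ ⊕₁ δʳ-n1 (nsuc n) B)                   ≈⟨ ⊗-resp ⊕-id refl ⟩⨾⟨refl ⟨
    ((id ⊕₁ id) ⊗₁ g) ⨾ δʳ ⨾ (unitˡ ⊕₁ δʳ-n1 (nsuc n) B)           ≈⟨ extendˡ δʳ-nat ⟩
    δʳ ⨾ ((id ⊗₁ g) ⊕₁ (id ⊗₁ g)) ⨾ (unitˡ ⊕₁ δʳ-n1 (nsuc n) B)    ≈⟨ refl⟩⨾⟨ ⊕-⨾ ⟨
    δʳ ⨾ (((id ⊗₁ g) ⨾ unitˡ) ⊕₁ ((id ⊗₁ g) ⨾ δʳ-n1 (nsuc n) B))   ≈⟨ refl⟩⨾⟨ ⊕-resp unitˡ-nat (δʳ-n1-natural (nsuc n) g) ⟩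
    δʳ ⨾ ((unitˡ ⨾ g) ⊕₁ (δʳ-n1 (nsuc n) A ⨾ times₁ (nsuc n) g))   ≈⟨ refl⟩⨾⟨ ⊕-⨾ ⟩
    δʳ ⨾ (unitˡ ⊕₁ δʳ-n1 (nsuc n) A) ⨾ (g ⊕₁ times₁ (nsuc n) g)    ≈⟨ assoc ⟨
    (δʳ ⨾ (unitˡ ⊕₁ δʳ-n1 (nsuc n) A)) ⨾ (g ⊕₁ times₁ (nsuc n) g)  ∎

  δʳ-n1-α : ∀ n {X Y} → α ⨾ (δʳ-n1 n X ⊗₁ id {Y}) ⨾ δʳ-nY n X Y ≈ δʳ-n1 n (X ⊗₀ Y)
  δʳ-n1-α nzero           = laplaza-XVI
  δʳ-n1-α (nsuc nzero)    = trans (refl⟩⨾⟨ idʳ) α-unitˡ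
  δʳ-n1-α (nsuc (nsuc n)) {X} {Y} = begin
    α ⨾ ((δʳ ⨾ (unitˡ ⊕₁ D)) ⊗₁ id) ⨾ δʳ ⨾ (id ⊕₁ E)                   ≈⟨ refl⟩⨾⟨ pushˡ ⨾⊗id ⟩
    α ⨾ (δʳ ⊗₁ id) ⨾ ((unitˡ ⊕₁ D) ⊗₁ id) ⨾ δʳ ⨾ (id ⊕₁ E)             ≈⟨ refl⟩⨾⟨ refl⟩⨾⟨ extendˡ δʳ-nat ⟩
    α ⨾ (δʳ ⊗₁ id) ⨾ δʳ ⨾ ((unitˡ ⊗₁ id) ⊕₁ (D ⊗₁ id)) ⨾ (id ⊕₁ E)    ≈⟨ pull₃ laplaza-VIII ⟩
    (δʳ ⨾ (α ⊕₁ α)) ⨾ ((unitˡ ⊗₁ id) ⊕₁ (D ⊗₁ id)) ⨾ (id ⊕₁ E)         ≈⟨ assoc ⟩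
    δʳ ⨾ (α ⊕₁ α) ⨾ ((unitˡ ⊗₁ id) ⊕₁ (D ⊗₁ id)) ⨾ (id ⊕₁ E)           ≈⟨ refl⟩⨾⟨ refl⟩⨾⟨ ⊕-⨾ ⟨
    δʳ ⨾ (α ⊕₁ α) ⨾ (((unitˡ ⊗₁ id) ⨾ id) ⊕₁ ((D ⊗₁ id) ⨾ E))          ≈⟨ refl⟩⨾⟨ ⊕-⨾ ⟨
    δʳ ⨾ ((α ⨾ (unitˡ ⊗₁ id) ⨾ id) ⊕₁ (α ⨾ (D ⊗₁ id) ⨾ E))            ≈⟨ refl⟩⨾⟨ ⊕-resp (δʳ-n1-α 1) (δʳ-n1-α (nsuc n)) ⟩
    δʳ ⨾ (unitˡ ⊕₁ δʳ-n1 (nsuc n) (X ⊗₀ Y))                            ∎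
    where
      D : (times ⊕S (nsuc n) unit ⊗₀ X) ⇒ times ⊕S (nsuc n) X
      D = δʳ-n1 (nsuc n) X
      E : (times ⊕S (nsuc n) X ⊗₀ Y) ⇒ times ⊕S (nsuc n) (X ⊗₀ Y)
      E = δʳ-nY (nsuc n) X Y

  δʳ-n1-α⁻¹ : ∀ n {X Y} → (δʳ-n1 n X ⊗₁ id {Y}) ⨾ δʳ-nY n X Y ≈ α⁻¹ ⨾ δʳ-n1 n (X ⊗₀ Y)
  δʳ-n1-α⁻¹ n = trans (sym (cancelˡ α-isoʳ)) (refl⟩⨾⟨ δʳ-n1-α n)

  σ-δˡ-nX : ∀ n {X Y} → σ ⨾ δˡ-nX Y n X ≈ δʳ-nY n X Y ⨾ times₁ n σ
  σ-δˡ-nX nzero           = trans (refl⟩⨾⟨ laplaza-XV) (trans (cancelˡ σ-inv) (sym idʳ))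
  σ-δˡ-nX (nsuc nzero)    = trans idʳ (sym idˡ)
  σ-δˡ-nX (nsuc (nsuc n)) {X} {Y} = begin
    σ ⨾ δˡ ⨾ (id ⊕₁ δˡ-nX Y (nsuc n) X)                   ≈⟨ extendˡ laplaza-II ⟨
    δʳ ⨾ (σ ⊕₁ σ) ⨾ (id ⊕₁ δˡ-nX Y (nsuc n) X)            ≈⟨ refl⟩⨾⟨ ⊕-⨾ ⟨
    δʳ ⨾ ((σ ⨾ id) ⊕₁ (σ ⨾ δˡ-nX Y (nsuc n) X))           ≈⟨ refl⟩⨾⟨ ⊕-resp (trans idʳ (sym idˡ)) (σ-δˡ-nX (nsuc n)) ⟩
    δʳ ⨾ ((id ⨾ σ) ⊕₁ (δʳ-nY (nsuc n) X Y ⨾ times₁ (nsuc n) σ)) ≈⟨ refl⟩⨾⟨ ⊕-⨾ ⟩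
    δʳ ⨾ (id ⊕₁ δʳ-nY (nsuc n) X Y) ⨾ (σ ⊕₁ times₁ (nsuc n) σ)  ≈⟨ assoc ⟨
    (δʳ ⨾ (id ⊕₁ δʳ-nY (nsuc n) X Y)) ⨾ (σ ⊕₁ times₁ (nsuc n) σ) ∎

  -- The paper's h_X; opAt f X is definitionally actAt (arity f) (i (opL T f)) X.
  actAt : ∀ n → unit ⇒ times ⊕S n unit → (X : Obj) → X ⇒ times ⊕S n X
  actAt n h X = unitˡ⁻¹ ⨾ (h ⊗₁ id) ⨾ δʳ-n1 n X

  module _ (n : ℕ) (h : unit ⇒ times ⊕S n unit) where

    actAt-natural : ∀ {A B} (g : A ⇒ B) → actAt n h A ⨾ times₁ n g ≈ g ⨾ actAt n h B
    actAt-natural {A} {B} g = begin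
      (unitˡ⁻¹ ⨾ (h ⊗₁ id) ⨾ δʳ-n1 n A) ⨾ times₁ n g   ≈⟨ trans assoc (refl⟩⨾⟨ assoc) ⟩
      unitˡ⁻¹ ⨾ (h ⊗₁ id) ⨾ δʳ-n1 n A ⨾ times₁ n g     ≈⟨ refl⟩⨾⟨ refl⟩⨾⟨ δʳ-n1-natural n g ⟨
      unitˡ⁻¹ ⨾ (h ⊗₁ id) ⨾ (id ⊗₁ g) ⨾ δʳ-n1 n B      ≈⟨ refl⟩⨾⟨ extendˡ ⊗-slide ⟩
      unitˡ⁻¹ ⨾ (id ⊗₁ g) ⨾ (h ⊗₁ id) ⨾ δʳ-n1 n B      ≈⟨ extendˡ unitˡ⁻¹-nat ⟨
      g ⨾ unitˡ⁻¹ ⨾ (h ⊗₁ id) ⨾ δʳ-n1 n B              ∎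

    actAt-⊗ʳ : ∀ X Y → (actAt n h X ⊗₁ id {Y}) ⨾ δʳ-nY n X Y ≈ actAt n h (X ⊗₀ Y)
    actAt-⊗ʳ X Y = begin
      ((unitˡ⁻¹ ⨾ (h ⊗₁ id) ⨾ δʳ-n1 n X) ⊗₁ id) ⨾ δʳ-nY n X Y
        ≈⟨ trans (pushˡ ⨾⊗id) (refl⟩⨾⟨ pushˡ ⨾⊗id) ⟩
      (unitˡ⁻¹ ⊗₁ id) ⨾ ((h ⊗₁ id) ⊗₁ id) ⨾ (δʳ-n1 n X ⊗₁ id) ⨾ δʳ-nY n X Y
        ≈⟨ refl⟩⨾⟨ refl⟩⨾⟨ δʳ-n1-α⁻¹ n ⟩
      (unitˡ⁻¹ ⊗₁ id) ⨾ ((h ⊗₁ id) ⊗₁ id) ⨾ α⁻¹ ⨾ δʳ-n1 n (X ⊗₀ Y)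
        ≈⟨ refl⟩⨾⟨ extendˡ α⁻¹-nat ⟩
      (unitˡ⁻¹ ⊗₁ id) ⨾ α⁻¹ ⨾ (h ⊗₁ (id ⊗₁ id)) ⨾ δʳ-n1 n (X ⊗₀ Y)
        ≈⟨ refl⟩⨾⟨ refl⟩⨾⟨ ⊗-resp refl ⊗-id ⟩⨾⟨refl ⟩
      (unitˡ⁻¹ ⊗₁ id) ⨾ α⁻¹ ⨾ (h ⊗₁ id) ⨾ δʳ-n1 n (X ⊗₀ Y)
        ≈⟨ pullˡ unitˡ⁻¹-α⁻¹ ⟩
      unitˡ⁻¹ ⨾ (h ⊗₁ id) ⨾ δʳ-n1 n (X ⊗₀ Y)
        ∎

    actAt-⊗ˡ : ∀ X Y → (id {Y} ⊗₁ actAt n h X) ⨾ δˡ-nX Y n X ≈ actAt n h (Y ⊗₀ X)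
    actAt-⊗ˡ X Y = begin
      (id ⊗₁ F) ⨾ δˡ-nX Y n X                       ≈⟨ cancelˡ σ-inv ⟨
      σ ⨾ σ ⨾ (id ⊗₁ F) ⨾ δˡ-nX Y n X               ≈⟨ refl⟩⨾⟨ extendˡ σ-nat ⟨
      σ ⨾ (F ⊗₁ id) ⨾ σ ⨾ δˡ-nX Y n X               ≈⟨ refl⟩⨾⟨ refl⟩⨾⟨ σ-δˡ-nX n ⟩
      σ ⨾ (F ⊗₁ id) ⨾ δʳ-nY n X Y ⨾ times₁ n σ      ≈⟨ refl⟩⨾⟨ pullˡ (actAt-⊗ʳ X Y) ⟩
      σ ⨾ actAt n h (X ⊗₀ Y) ⨾ times₁ n σ           ≈⟨ refl⟩⨾⟨ actAt-natural σ ⟩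
      σ ⨾ σ ⨾ actAt n h (Y ⊗₀ X)                    ≈⟨ cancelˡ σ-inv ⟩
      actAt n h (Y ⊗₀ X)                            ∎
      where
        F : X ⇒ times ⊕S n X
        F = actAt n h X

lemma37 : ∀ {o ℓ e : Level} (T : Theory) (R : TRigCategory T o ℓ e) →
    let open TRigOps R in
    ∀ (f : Signature.Op (Theory.sig T)) (X Y : Obj) →
      ((opAt f X ⊗₁ id {Y}) ⨾ δʳ-nY (Signature.arity (Theory.sig T) f) X Y ≈ opAt f (X ⊗₀ Y))
      × ((id {Y} ⊗₁ opAt f X) ⨾ δˡ-nX Y (Signature.arity (Theory.sig T) f) X ≈ opAt f (Y ⊗₀ X))
lemma37 T R f X Y = actAt-⊗ʳ n (i (opL T f)) X Y , actAt-⊗ˡ n (i (opL T f)) X Y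
  where
    open TRigCategory R using (i)
    open TRigProperties R using (actAt-⊗ʳ; actAt-⊗ˡ)
    n : ℕ
    n = Signature.arity (Theory.sig T) f
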